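{- Let $n\geq 10$ and consider the cycle $C_n$. (i) If $S$ is an MTDS of $C_n$ such that $C_n[S]$ contains a $P_4$ component, then $S$ lies in the same component of $D_{|S|+1}^t(C_n)$ as some MTDS $S'$ of $C_n$ such that $C_n[S']$ has no $P_4$ components. (ii) If $S$ is an MTDS of $C_n$ such that $C_n[S]$ contains two consecutive $P_3$ components, then $S$ lies in the same component of $D_{|S|+1}^t(C_n)$ as some MTDS $S'$ such that $C_n[S']$ has fewer $P_3$ components than $C_n[S]$. (iii) If $S$ is an MTDS of $C_n$ such that $C_n[S]$ contains at least one $P_3$ component and at least one $P_2$ component but no $P_4$ components, then $S$ lies in the same component of $D_{\Gamma_t(C_n)+1}^t(C_n)$ as some MTDS $S'$ such that $C_n[S']$ has no $P_3$ components.
   Context: $C_n=(v_0,v_1,\dots,v_{n-1},v_0)$ is the cycle on $n$ vertices, and $C_n[S]$ is the subgraph induced by $S$; its components are paths, considered in cyclic order around $C_n$ (two components are consecutive if no other component of $C_n[S]$ lies between them along the cycle). A total dominating set (TDS) is a vertex set $S$ such that every vertex is adjacent to a vertex of $S$; an MTDS is a TDS no proper subset of which is a TDS. $\Gamma_t(C_n)$ is the maximum cardinality of an MTDS of $C_n$. For a positive integer $k$, $D_k^t(G)$ is the graph whose vertices are the TDSs of $G$ of cardinality at most $k$, two being adjacent if and only if one is obtained from the other by adding or deleting a single vertex. -}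

module Defs where

open import Data.Nat using (ℕ; zero; suc; _+_; _∸_; _≤_; _<_; NonZero; _%_)
open import Data.Nat.DivMod using (m%n<n)
open import Data.Fin using (Fin; toℕ; fromℕ<)
open import Data.Fin.Subset using (Subset; _∈_; _∉_; _⊂_; ∣_∣; _∪_; ⁅_⁆)
open import Data.Vec using (lookup; tabulate)
open import Data.Bool using (Bool; true; false; _∧_; not)
open import Data.Product using (∃; ∃-syntax; _×_)
open import Data.Sum using (_⊎_)
open import Relation.Binary.PropositionalEquality using (_≡_)
open import Relation.Nullary using (¬_)
open import Relation.Binary.Construct.Closure.ReflexiveTransitive using (Star)

-- Vertices of C_n are Fin n (v_i = i); vtx n m is the vertex v_{m mod n}.
vtx : (n : ℕ) → .{{_ : NonZero n}} → ℕ → Fin n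
vtx n m = fromℕ< (m%n<n m n)

Adj : (n : ℕ) → .{{_ : NonZero n}} → Fin n → Fin n → Set
Adj n u v = (v ≡ vtx n (toℕ u + 1)) ⊎ (u ≡ vtx n (toℕ v + 1))

IsTDS : (n : ℕ) → .{{_ : NonZero n}} → Subset n → Set
IsTDS n S = ∀ (v : Fin n) → ∃[ u ] (Adj n v u × u ∈ S)

IsMTDS : (n : ℕ) → .{{_ : NonZero n}} → Subset n → Set
IsMTDS n S = IsTDS n S × (∀ (T : Subset n) → T ⊂ S → ¬ IsTDS n T)

IsGammaT : (n : ℕ) → .{{_ : NonZero n}} → ℕ → Set
IsGammaT n g = (∃[ S ] (IsMTDS n S × ∣ S ∣ ≡ g))
             × (∀ (S : Subset n) → IsMTDS n S → ∣ S ∣ ≤ g)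

memB : (n : ℕ) → .{{_ : NonZero n}} → Subset n → ℕ → Bool
memB n S m = lookup S (vtx n m)

runB : (n : ℕ) → .{{_ : NonZero n}} → Subset n → ℕ → ℕ → Bool
runB n S i zero = true
runB n S i (suc k) = memB n S (i + k) ∧ runB n S i k

-- compB n k S i = true iff C_n[S] has a P_k component whose first vertex
-- (in the cyclic order v_0, v_1, ...) is v_i, i.e. v_i..v_{i+k-1} ∈ S
-- and v_{i-1}, v_{i+k} ∉ S (indices mod n).
compB : (n : ℕ) → .{{_ : NonZero n}} → ℕ → Subset n → Fin n → Bool
compB n k S i =
  not (memB n S (toℕ i + (n ∸ 1))) ∧ runB n S (toℕ i) k ∧ not (memB n S (toℕ i + k))

countComp : (n : ℕ) → .{{_ : NonZero n}} → ℕ → Subset n → ℕ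
countComp n k S = ∣ tabulate (compB n k S) ∣

-- C_n[S] has two (distinct) consecutive P_3 components: P_3 components
-- starting at v_i and v_j, with no vertex of S strictly between the end
-- of the first (v_{i+2}) and the start of the second (v_j) along the cycle.
HasConsecP3 : (n : ℕ) → .{{_ : NonZero n}} → Subset n → Set
HasConsecP3 n S = ∃[ i ] ∃[ j ] (¬ (i ≡ j) × compB n 3 S i ≡ true × compB n 3 S j ≡ true
  × ∃[ d ] (vtx n (toℕ i + 3 + d) ≡ j × (∀ t → t < d → memB n S (toℕ i + 3 + t) ≡ false)))

AddOne : {n : ℕ} → Subset n → Subset n → Set
AddOne S T = ∃[ v ] (v ∉ S × T ≡ S ∪ ⁅ v ⁆)

-- Adjacency in D_k^t(C_n): both are TDSs of size ≤ k, one obtained from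
-- the other by adding or deleting a single vertex.
DStep : (n : ℕ) → .{{_ : NonZero n}} → ℕ → Subset n → Subset n → Set
DStep n k S T = IsTDS n S × IsTDS n T × ∣ S ∣ ≤ k × ∣ T ∣ ≤ k × (AddOne S T ⊎ AddOne T S)

-- S and T lie in the same component of D_k^t(C_n)
-- (for S a TDS with |S| ≤ k; DStep is symmetric, so Star is connectivity).
SameComp : (n : ℕ) → .{{_ : NonZero n}} → ℕ → Subset n → Subset n → Set
SameComp n k = Star (DStep n k)

module Submission where

-- On C_n all properties involved are local: S is a TDS iff every v_{x+1} has v_x or
-- v_{x+2} in S, and a TDS is minimal iff no v_x, v_{x+2}, v_{x+4} all lie in S. Such conditions
-- are five-bit patterns on the membership sequence of S. Each part of the lemma is proved by
-- repeating a local move: around a run of four (i), two consecutive P_3 components (ii) or a run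
-- of three (iii), the bits of a window of the cycle are flipped one at a time. That the chosen
-- flips stay among TDSs of bounded size, end in a minimal TDS and decrease the number of runs
-- (or of P_3 components) is checked by evaluation, once, for every window that is locally a
-- minimal TDS: these are the certificates below.

open import Defs
open import Data.Nat using (ℕ; zero; suc; _+_; _*_; _∸_; _≤_; _<_; _⊔_; NonZero; >-nonZero⁻¹; _%_; _/_; z≤n; s≤s; _≤ᵇ_; _<?_)
  renaming (_≟_ to _≟ℕ_)
open import Data.Nat.Properties
open import Data.Nat.DivMod
open import Data.Nat.Solver using (module +-*-Solver)
open import Data.Bool using (Bool; true; false; _∧_; _∨_; not; if_then_else_)
open import Data.Bool.Properties using (∨-identityʳ; ∨-zeroʳ)
open import Data.List using (List; []; _∷_; length; _++_; take; drop)
open import Data.List.Properties using (++-identityʳ; ++-assoc)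
open import Data.Fin as Fin using (Fin; toℕ) renaming (_≟_ to _≟ᶠ_)
open import Data.Fin.Properties using (fromℕ<-cong; toℕ-fromℕ<; toℕ-injective; toℕ<n)
open import Data.Fin.Subset using (Subset; _∈_; _∉_; _⊂_; ∣_∣; _∪_; ⁅_⁆)
open import Data.Fin.Subset.Properties using (∪-identityʳ)
open import Data.Vec using ([]; _∷_; lookup; tabulate; updateAt)
open import Data.Vec.Properties using (lookup∘updateAt; lookup∘updateAt′; []=⇒lookup; lookup⇒[]=)
open import Data.Product using (∃-syntax; _×_; _,_; proj₁; proj₂)
open import Data.Sum using (_⊎_; inj₁; inj₂)
open import Data.Empty using (⊥; ⊥-elim)
open import Relation.Binary.PropositionalEquality
open import Relation.Binary.Construct.Closure.ReflexiveTransitive using (Star; ε; _◅_; _◅◅_)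
open import Relation.Nullary using (¬_; yes; no)
open import Induction.WellFounded using (Acc; acc)
open import Data.Nat.Induction using (<-wellFounded)

-- bits: ○ for a vertex outside S, ● for a vertex in S
pattern ○ = false
pattern ● = true

∧-split : ∀ {a b} → a ∧ b ≡ true → a ≡ true × b ≡ true
∧-split {true} e = refl , e

∧-intro : ∀ {a b} → a ≡ true → b ≡ true → a ∧ b ≡ true
∧-intro refl refl = refl

∨-split : ∀ {a b} → a ∨ b ≡ true → a ≡ true ⊎ b ≡ true
∨-split {true} _ = inj₁ refl
∨-split {false} e = inj₂ e

∨-introˡ : ∀ {a} b → a ≡ true → a ∨ b ≡ true
∨-introˡ b refl = refl

∨-introʳ : ∀ a {b} → b ≡ true → a ∨ b ≡ true
∨-introʳ a refl = ∨-zeroʳ a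

true≢false : ∀ {b} → b ≡ true → b ≡ false → ∀ {A : Set} → A
true≢false refl ()

¬true⇒false : ∀ {b} → ¬ b ≡ true → b ≡ false
¬true⇒false {false} _ = refl
¬true⇒false {true} ne = ⊥-elim (ne refl)

_⇒ᵇ_ : Bool → Bool → Bool
a ⇒ᵇ b = not a ∨ b

⇒ᵇ-elim : ∀ {a b} → a ⇒ᵇ b ≡ true → a ≡ true → b ≡ true
⇒ᵇ-elim {true} h refl = h

≤ᵇ-sound : ∀ {m n} → (m ≤ᵇ n) ≡ true → m ≤ n
≤ᵇ-sound {m} {n} e = ≤ᵇ⇒≤ m n (subst Data.Bool.T (sym e) _)

bit : Bool → ℕ
bit true = 1
bit false = 0

sumBelow : ℕ → (ℕ → ℕ) → ℕ
sumBelow zero h = 0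
sumBelow (suc k) h = h 0 + sumBelow k (λ i → h (suc i))

allBelow : ℕ → (ℕ → Bool) → Bool
allBelow zero h = true
allBelow (suc k) h = h k ∧ allBelow k h

allBelow-intro : ∀ k h → (∀ x → x < k → h x ≡ true) → allBelow k h ≡ true
allBelow-intro zero h f = refl
allBelow-intro (suc k) h f = ∧-intro (f k ≤-refl) (allBelow-intro k h (λ x lt → f x (m<n⇒m<1+n lt)))

allBelow-elim : ∀ k h → allBelow k h ≡ true → ∀ x → x < k → h x ≡ true
allBelow-elim (suc k) h e x x<k with m≤n⇒m<n∨m≡n (≤-pred x<k)
... | inj₁ lt = allBelow-elim k h (proj₂ (∧-split e)) x lt
... | inj₂ refl = proj₁ (∧-split e)

sumBelow-cong : ∀ k {h h'} → (∀ i → i < k → h i ≡ h' i) → sumBelow k h ≡ sumBelow k h'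
sumBelow-cong zero f = refl
sumBelow-cong (suc k) f = cong₂ _+_ (f 0 (s≤s z≤n)) (sumBelow-cong k (λ i lt → f (suc i) (s≤s lt)))

sumBelow-split : ∀ a b h → sumBelow (a + b) h ≡ sumBelow a h + sumBelow b (λ i → h (a + i))
sumBelow-split zero b h = refl
sumBelow-split (suc a) b h =
  trans (cong (h 0 +_) (sumBelow-split a b (λ i → h (suc i)))) (sym (+-assoc (h 0) _ _))

sumBelow-last : ∀ k h → sumBelow (suc k) h ≡ sumBelow k h + h k
sumBelow-last zero h = +-comm (h 0) 0
sumBelow-last (suc k) h =
  trans (cong (h 0 +_) (sumBelow-last k (λ i → h (suc i)))) (sym (+-assoc (h 0) _ _))

sumBelow-rotate : ∀ k h → (∀ i → h (i + k) ≡ h i) → ∀ q → sumBelow k (λ i → h (q + i)) ≡ sumBelow k h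
sumBelow-rotate k h periodic zero = refl
sumBelow-rotate k h periodic (suc q) = trans (shift k refl) (sumBelow-rotate k h periodic q)
  where
  -- moving the start one step right drops h q and adds h (q + k) = h q
  shift : ∀ j → j ≡ k → sumBelow j (λ i → h (suc q + i)) ≡ sumBelow j (λ i → h (q + i))
  shift zero _ = refl
  shift (suc j) j≡k = begin
    sumBelow (suc j) (λ i → h (suc q + i))           ≡⟨ sumBelow-last j _ ⟩
    sumBelow j (λ i → h (suc q + i)) + h (suc q + j)
      ≡⟨ cong₂ _+_ (sumBelow-cong j (λ i _ → cong h (sym (+-suc q i)))) wrap ⟩
    sumBelow j (λ i → h (q + suc i)) + h (q + 0)     ≡⟨ +-comm _ (h (q + 0)) ⟩
    sumBelow (suc j) (λ i → h (q + i))               ∎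
    where
    open ≡-Reasoning
    wrap : h (suc q + j) ≡ h (q + 0)
    wrap = begin
      h (suc q + j) ≡⟨ cong h (trans (sym (+-suc q j)) (cong (q +_) j≡k)) ⟩
      h (q + k)     ≡⟨ periodic q ⟩
      h q           ≡⟨ cong h (sym (+-identityʳ q)) ⟩
      h (q + 0)     ∎

sumBelow-zero : ∀ k h → sumBelow k h ≡ 0 → ∀ i → i < k → h i ≡ 0
sumBelow-zero (suc k) h e zero _ = m+n≡0⇒m≡0 (h 0) e
sumBelow-zero (suc k) h e (suc i) (s≤s lt) = sumBelow-zero k (λ i → h (suc i)) (m+n≡0⇒n≡0 (h 0) e) i lt

sumBelow-nonzero : ∀ k h → ¬ sumBelow k h ≡ 0 → ∃[ i ] ¬ h i ≡ 0
sumBelow-nonzero zero h ne = ⊥-elim (ne refl)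
sumBelow-nonzero (suc k) h ne with h 0 ≟ℕ 0
... | no h0≢0 = 0 , h0≢0
... | yes h0≡0 with sumBelow-nonzero k (λ i → h (suc i)) (λ e → ne (cong₂ _+_ h0≡0 e))
...   | i , hi≢0 = suc i , hi≢0

-- Words: finite bit strings, read as the membership pattern of a stretch of the cycle.

Word : Set
Word = List Bool

at : Word → ℕ → Bool
at [] _ = false
at (b ∷ _) zero = b
at (_ ∷ bs) (suc i) = at bs i

flipAt : Word → ℕ → Word
flipAt [] _ = []
flipAt (b ∷ bs) zero = not b ∷ bs
flipAt (b ∷ bs) (suc c) = b ∷ flipAt bs c

flipAll : Word → List ℕ → Word
flipAll u [] = u
flipAll u (c ∷ cs) = flipAll (flipAt u c) cs

weight : Word → ℕ
weight [] = 0
weight (b ∷ bs) = bit b + weight bs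

read : (ℕ → Bool) → ℕ → Word
read f zero = []
read f (suc k) = f 0 ∷ read (λ i → f (suc i)) k

at-read : ∀ f k x → x < k → at (read f k) x ≡ f x
at-read f (suc k) zero _ = refl
at-read f (suc k) (suc x) (s≤s lt) = at-read (λ i → f (suc i)) k x lt

length-read : ∀ f k → length (read f k) ≡ k
length-read f zero = refl
length-read f (suc k) = cong suc (length-read (λ i → f (suc i)) k)

read-cong : ∀ {f g} k → (∀ y → y < k → f y ≡ g y) → read f k ≡ read g k
read-cong zero h = refl
read-cong (suc k) h = cong₂ _∷_ (h 0 (s≤s z≤n)) (read-cong k (λ y lt → h (suc y) (s≤s lt)))

take-drop-read : ∀ f s k L → s + k ≤ L → take k (drop s (read f L)) ≡ read (λ y → f (s + y)) k
take-drop-read f zero k L le = prefix f k L le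
  where
  prefix : ∀ f k L → k ≤ L → take k (read f L) ≡ read f k
  prefix f zero L _ = refl
  prefix f (suc k) (suc L) (s≤s le) = cong (f 0 ∷_) (prefix (λ i → f (suc i)) k L le)
take-drop-read f (suc s) k (suc L) (s≤s le) = take-drop-read (λ i → f (suc i)) s k L le

length-flipAt : ∀ u c → length (flipAt u c) ≡ length u
length-flipAt [] c = refl
length-flipAt (b ∷ u) zero = refl
length-flipAt (b ∷ u) (suc c) = cong suc (length-flipAt u c)

at-flipAt-same : ∀ u c → c < length u → at (flipAt u c) c ≡ not (at u c)
at-flipAt-same (b ∷ u) zero _ = refl
at-flipAt-same (b ∷ u) (suc c) (s≤s lt) = at-flipAt-same u c lt

at-flipAt-other : ∀ u c x → ¬ x ≡ c → at (flipAt u c) x ≡ at u x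
at-flipAt-other [] c x ne = refl
at-flipAt-other (b ∷ u) zero zero ne = ⊥-elim (ne refl)
at-flipAt-other (b ∷ u) zero (suc x) ne = refl
at-flipAt-other (b ∷ u) (suc c) zero ne = refl
at-flipAt-other (b ∷ u) (suc c) (suc x) ne = at-flipAt-other u c x (λ e → ne (cong suc e))

weight-flipAt-up : ∀ u c → c < length u → at u c ≡ false → weight (flipAt u c) ≡ suc (weight u)
weight-flipAt-up (false ∷ u) zero _ refl = refl
weight-flipAt-up (b ∷ u) (suc c) (s≤s lt) e =
  trans (cong (bit b +_) (weight-flipAt-up u c lt e)) (+-suc (bit b) (weight u))

weight-flipAt-down : ∀ u c → c < length u → at u c ≡ true → weight u ≡ suc (weight (flipAt u c))
weight-flipAt-down (true ∷ u) zero _ refl = refl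
weight-flipAt-down (b ∷ u) (suc c) (s≤s lt) e =
  trans (cong (bit b +_) (weight-flipAt-down u c lt e)) (+-suc (bit b) (weight (flipAt u c)))

-- Five-bit patterns. Every property of C_n used here is a condition on five consecutive
-- vertices v_x, ..., v_{x+4}; `holds P f x` evaluates P on the bits f x, ..., f (x + 4).

Pattern : Set
Pattern = Bool → Bool → Bool → Bool → Bool → Bool

holds : Pattern → (ℕ → Bool) → ℕ → Bool
holds P f x = P (f x) (f (x + 1)) (f (x + 2)) (f (x + 3)) (f (x + 4))

holds-cong : ∀ P f g a b → (∀ j → j ≤ 4 → f (a + j) ≡ g (b + j)) → holds P f a ≡ holds P g b
holds-cong P f g a b F
  rewrite F 1 (s≤s z≤n) | F 2 (s≤s (s≤s z≤n)) | F 3 (s≤s (s≤s (s≤s z≤n))) | F 4 (s≤s (s≤s (s≤s (s≤s z≤n))))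
        | trans (cong f (sym (+-identityʳ a))) (trans (F 0 z≤n) (cong g (+-identityʳ b))) = refl

holds-read : ∀ P f L k → k + 4 < L → holds P (at (read f L)) k ≡ holds P f k
holds-read P f L k k+4<L = holds-cong P (at (read f L)) f k k
  (λ j j≤4 → at-read f L (k + j) (≤-<-trans (+-monoʳ-≤ k j≤4) k+4<L))

-- v_{x+1} has a neighbour (v_x or v_{x+2}) in S
dominatesNext : Pattern
dominatesNext a b c d e = a ∨ c

-- v_{x+2} is not redundant: it is not the case that v_x, v_{x+2}, v_{x+4} ∈ S
-- (then both neighbours of v_{x+2} would stay dominated without it)
irredundant : Pattern
irredundant a b c d e = not (a ∧ (c ∧ e))

run4 : Pattern
run4 a b c d e = a ∧ (b ∧ (c ∧ d))

noRun4 : Pattern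
noRun4 a b c d e = not (a ∧ (b ∧ (c ∧ d)))

run3 : Pattern
run3 a b c d e = a ∧ (b ∧ c)

-- v_{x+1}, v_{x+2}, v_{x+3} form a P_3 component of C_n[S]
p3Component : Pattern
p3Component a b c d e = not a ∧ ((d ∧ (c ∧ (b ∧ true))) ∧ not e)

minimalTDS minimalTDSnoRun4 : Pattern
minimalTDS a b c d e = dominatesNext a b c d e ∧ irredundant a b c d e
minimalTDSnoRun4 a b c d e = dominatesNext a b c d e ∧ (irredundant a b c d e ∧ noRun4 a b c d e)

countIn : Pattern → ℕ → Word → ℕ
countIn P m w = sumBelow m (λ x → bit (holds P (at w) x))

-- Exhaustive search. `consistent P w`: P holds at every complete five-bit window of w.
-- `forAllExtensions P k pre Q` checks Q on every consistent extension of pre by k bits,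
-- pruning inconsistent prefixes early.

consistent : Pattern → Word → Bool
consistent P (a ∷ b ∷ c ∷ d ∷ e ∷ r) = P a b c d e ∧ consistent P (b ∷ c ∷ d ∷ e ∷ r)
consistent P _ = true

consistent-prefix : ∀ P xs ys → consistent P (xs ++ ys) ≡ true → consistent P xs ≡ true
consistent-prefix P (a ∷ b ∷ c ∷ d ∷ e ∷ r) ys h =
  ∧-intro (proj₁ (∧-split h)) (consistent-prefix P (b ∷ c ∷ d ∷ e ∷ r) ys (proj₂ (∧-split h)))
consistent-prefix P [] ys h = refl
consistent-prefix P (_ ∷ []) ys h = refl
consistent-prefix P (_ ∷ _ ∷ []) ys h = refl
consistent-prefix P (_ ∷ _ ∷ _ ∷ []) ys h = refl
consistent-prefix P (_ ∷ _ ∷ _ ∷ _ ∷ []) ys h = refl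

consistent-read : ∀ P k f → (∀ x → holds P f x ≡ true) → consistent P (read f k) ≡ true
consistent-read P (suc (suc (suc (suc (suc k))))) f h =
  ∧-intro (h 0) (consistent-read P (suc (suc (suc (suc k)))) (λ i → f (suc i)) (λ x → h (suc x)))
consistent-read P zero f h = refl
consistent-read P (suc zero) f h = refl
consistent-read P (suc (suc zero)) f h = refl
consistent-read P (suc (suc (suc zero))) f h = refl
consistent-read P (suc (suc (suc (suc zero)))) f h = refl

forAllExtensions : Pattern → ℕ → Word → (Word → Bool) → Bool
forAllExtensions P zero pre Q = if consistent P pre then Q pre else true
forAllExtensions P (suc k) pre Q =
  if consistent P pre
  then forAllExtensions P k (pre ++ ○ ∷ []) Q ∧ forAllExtensions P k (pre ++ ● ∷ []) Q
  else true

forAllExtensions-sound : ∀ P k pre Q → forAllExtensions P k pre Q ≡ true →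
  ∀ c → length c ≡ k → consistent P (pre ++ c) ≡ true → Q (pre ++ c) ≡ true
forAllExtensions-sound P zero pre Q h [] refl ok with consistent P pre in e
... | true = subst (λ z → Q z ≡ true) (sym (++-identityʳ pre)) h
... | false = true≢false (subst (λ z → consistent P z ≡ true) (++-identityʳ pre) ok) e
forAllExtensions-sound P (suc k) pre Q h (b ∷ c) len ok with consistent P pre in e
... | false = true≢false (consistent-prefix P pre (b ∷ c) ok) e
... | true = subst (λ z → Q z ≡ true) (++-assoc pre (b ∷ []) c)
               (forAllExtensions-sound P k (pre ++ b ∷ []) Q (branch b (∧-split h)) c (suc-injective len)
                 (subst (λ z → consistent P z ≡ true) (sym (++-assoc pre (b ∷ []) c)) ok))
  where
  branch : ∀ b → forAllExtensions P k (pre ++ ○ ∷ []) Q ≡ true × forAllExtensions P k (pre ++ ● ∷ []) Q ≡ true →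
           forAllExtensions P k (pre ++ b ∷ []) Q ≡ true
  branch ○ = proj₁
  branch ● = proj₂

forAllExtensions-read : ∀ P k Q → forAllExtensions P k [] Q ≡ true →
  ∀ f → (∀ x → holds P f x ≡ true) → Q (read f k) ≡ true
forAllExtensions-read P k Q h f hf =
  forAllExtensions-sound P k [] Q h (read f k) (length-read f k) (consistent-read P k f hf)

-- A window is a word of length m + 4; its complete five-bit windows start at
-- positions 0, ..., m - 1, and only positions in [4, m) are ever flipped, so that every
-- five-bit window touching a flipped bit lies inside the word.

validFlips : ℕ → ℕ → Word → List ℕ → Bool
validFlips m B u [] = true
validFlips m B u (c ∷ cs) =
  (4 ≤ᵇ c) ∧ ((suc c ≤ᵇ m) ∧ (allBelow m (holds dominatesNext (at (flipAt u c)))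
    ∧ ((weight (flipAt u c) ≤ᵇ B) ∧ validFlips m B (flipAt u c) cs)))

validFlips-head : ∀ {m B u c cs} → validFlips m B u (c ∷ cs) ≡ true →
  4 ≤ c × c < m × allBelow m (holds dominatesNext (at (flipAt u c))) ≡ true
  × weight (flipAt u c) ≤ B × validFlips m B (flipAt u c) cs ≡ true
validFlips-head ok with ∧-split ok
... | 4≤c , ok₁ with ∧-split ok₁
... | c<m , ok₂ with ∧-split ok₂
... | dom , ok₃ with ∧-split ok₃
... | wt≤B , ok₄ = ≤ᵇ-sound 4≤c , ≤ᵇ-sound c<m , dom , ≤ᵇ-sound wt≤B , ok₄

improves : ℕ → ℕ → Pattern → Word → List ℕ → Bool
improves m B P w cs =
  validFlips m B w cs ∧ (allBelow m (holds irredundant (at (flipAll w cs)))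
    ∧ (suc (countIn P m (flipAll w cs)) ≤ᵇ countIn P m w))

-- (i) Around a run of four at positions 7-10 of a window of length 14 of a minimal TDS, the
-- flips below (chosen by the shape of the left end of the window) decrease the number of runs
-- of four, never exceed the original weight by more than one, and do not increase it overall.
planI : Word → List ℕ
planI (_ ∷ _ ∷ ● ∷ _) = 6 ∷ 4 ∷ 8 ∷ []
planI (_ ∷ ● ∷ _) = 6 ∷ 8 ∷ []
planI _ = 5 ∷ 7 ∷ []

certifiedI : Word → Bool
certifiedI w = holds run4 (at w) 7 ⇒ᵇ
  (improves 10 (weight w + 1) run4 w (planI w) ∧ (weight (flipAll w (planI w)) ≤ᵇ weight w))

certifiedI-elim : ∀ w → certifiedI w ≡ true → holds run4 (at w) 7 ≡ true →
  improves 10 (weight w + 1) run4 w (planI w) ≡ true × weight (flipAll w (planI w)) ≤ weight w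
certifiedI-elim w cert anchor with ∧-split {improves 10 (weight w + 1) run4 w (planI w)} (⇒ᵇ-elim {holds run4 (at w) 7} cert anchor)
... | improving , lighter = improving , ≤ᵇ-sound lighter

certificateI : forAllExtensions minimalTDS 14 [] certifiedI ≡ true
certificateI = refl

-- (ii) Two P_3 components at positions 2-4 and 7-9 of a window of length 12 of a minimal TDS:
-- adding position 5 and then removing position 7 turns them into a P_4 followed by a P_2.
certifiedII : Word → Bool
certifiedII w = (holds p3Component (at w) 1 ∧ holds p3Component (at w) 6) ⇒ᵇ
  improves 8 (weight w + 1) p3Component w (5 ∷ 7 ∷ [])

certifiedII-elim : ∀ w → certifiedII w ≡ true → holds p3Component (at w) 1 ≡ true → holds p3Component (at w) 6 ≡ true →
  improves 8 (weight w + 1) p3Component w (5 ∷ 7 ∷ []) ≡ true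
certifiedII-elim w cert first second = ⇒ᵇ-elim {holds p3Component (at w) 1 ∧ holds p3Component (at w) 6} cert (∧-intro first second)

certificateII : forAllExtensions minimalTDS 12 [] certifiedII ≡ true
certificateII = refl

-- (iii) A run of three at positions 9-11 of a window of length 22 of a minimal TDS without
-- runs of four: a sub-window of length 14 starting at offset s ≤ 8 and flips inside it that
-- reduce the runs of three without creating a run of four.
planIII : Word → ℕ × List ℕ
planIII (● ∷ ● ∷ ● ∷ w) = if at w 13 then (5 , 7 ∷ 9 ∷ 8 ∷ 6 ∷ []) else (3 , 5 ∷ 9 ∷ 7 ∷ [])
planIII (○ ∷ ● ∷ _) = 0 , 4 ∷ 7 ∷ 9 ∷ 8 ∷ 6 ∷ []
planIII (● ∷ ● ∷ _) = 0 , 7 ∷ 9 ∷ 8 ∷ 6 ∷ []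
planIII _ = 0 , 7 ∷ 5 ∷ 9 ∷ []

checkWindowIII : Word → List ℕ → Bool
checkWindowIII v cs =
  improves 10 ((weight v ⊔ weight (flipAll v cs)) + 1) run3 v cs ∧ allBelow 10 (holds noRun4 (at (flipAll v cs)))

checkIII : Word → ℕ × List ℕ → Bool
checkIII w (s , cs) = (s ≤ᵇ 8) ∧ checkWindowIII (take 14 (drop s w)) cs

certifiedIII : Word → Bool
certifiedIII w = holds run3 (at w) 9 ⇒ᵇ checkIII w (planIII w)

certifiedIII-elim : ∀ w → certifiedIII w ≡ true → holds run3 (at w) 9 ≡ true →
  proj₁ (planIII w) ≤ 8 × checkWindowIII (take 14 (drop (proj₁ (planIII w)) w)) (proj₂ (planIII w)) ≡ true
certifiedIII-elim w cert anchor with ∧-split {proj₁ (planIII w) ≤ᵇ 8} (⇒ᵇ-elim {holds run3 (at w) 9} cert anchor)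
... | offset , window = ≤ᵇ-sound offset , window

certificateIII : forAllExtensions minimalTDSnoRun4 22 [] certifiedIII ≡ true
certificateIII = refl

toggle : ∀ {k} → Subset k → Fin k → Subset k
toggle S x = updateAt S x not

false⇒∉ : ∀ {k} {S : Subset k} {x} → lookup S x ≡ false → x ∉ S
false⇒∉ e x∈S = true≢false ([]=⇒lookup x∈S) e

toggle-⊂ : ∀ {k} (S : Subset k) x → lookup S x ≡ true → toggle S x ⊂ S
toggle-⊂ S x e = ⊆ , x , lookup⇒[]= x S e , false⇒∉ (trans (lookup∘updateAt x S) (cong not e))
  where
  ⊆ : ∀ {w} → w ∈ toggle S x → w ∈ S
  ⊆ {w} w∈T with w ≟ᶠ x
  ... | yes refl = true≢false ([]=⇒lookup w∈T) (trans (lookup∘updateAt x S) (cong not e))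
  ... | no w≢x = lookup⇒[]= w S (trans (sym (lookup∘updateAt′ w x w≢x S)) ([]=⇒lookup w∈T))

toggle-add : ∀ {k} (S : Subset k) x → lookup S x ≡ false → toggle S x ≡ S ∪ ⁅ x ⁆
toggle-add (false ∷ S) Fin.zero refl = cong (true ∷_) (sym (∪-identityʳ S))
toggle-add (b ∷ S) (Fin.suc x) e = cong₂ _∷_ (sym (∨-identityʳ b)) (toggle-add S x e)

toggle-remove : ∀ {k} (S : Subset k) x → lookup S x ≡ true → toggle S x ∪ ⁅ x ⁆ ≡ S
toggle-remove (true ∷ S) Fin.zero refl = cong (true ∷_) (∪-identityʳ S)
toggle-remove (b ∷ S) (Fin.suc x) e = cong₂ _∷_ (∨-identityʳ b) (toggle-remove S x e)

∣toggle∣-add : ∀ {k} (S : Subset k) x → lookup S x ≡ false → ∣ toggle S x ∣ ≡ suc ∣ S ∣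
∣toggle∣-add (false ∷ S) Fin.zero refl = refl
∣toggle∣-add (true ∷ S) (Fin.suc x) e = cong suc (∣toggle∣-add S x e)
∣toggle∣-add (false ∷ S) (Fin.suc x) e = ∣toggle∣-add S x e

∣toggle∣-remove : ∀ {k} (S : Subset k) x → lookup S x ≡ true → ∣ S ∣ ≡ suc ∣ toggle S x ∣
∣toggle∣-remove (true ∷ S) Fin.zero refl = refl
∣toggle∣-remove (true ∷ S) (Fin.suc x) e = cong suc (∣toggle∣-remove S x e)
∣toggle∣-remove (false ∷ S) (Fin.suc x) e = ∣toggle∣-remove S x e

∣_∣-cons : ∀ {k} b (v : Subset k) → ∣ b ∷ v ∣ ≡ bit b + ∣ v ∣
∣ true ∣-cons v = refl
∣ false ∣-cons v = refl

∣tabulate∣ : ∀ {k} (f : Fin k → Bool) (h : ℕ → ℕ) → (∀ i → h (toℕ i) ≡ bit (f i)) → ∣ tabulate f ∣ ≡ sumBelow k h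
∣tabulate∣ {zero} f h e = refl
∣tabulate∣ {suc k} f h e =
  trans (∣ f Fin.zero ∣-cons (tabulate (λ i → f (Fin.suc i)))) (cong₂ _+_ (sym (e Fin.zero)) (∣tabulate∣ (λ i → f (Fin.suc i)) (λ i → h (suc i)) (λ i → e (Fin.suc i))))

∣tabulate∣-zero : ∀ {k} (f : Fin k → Bool) → (∀ i → f i ≡ false) → ∣ tabulate f ∣ ≡ 0
∣tabulate∣-zero {zero} f e = refl
∣tabulate∣-zero {suc k} f e =
  trans (∣ f Fin.zero ∣-cons (tabulate (λ i → f (Fin.suc i)))) (cong₂ _+_ (cong bit (e Fin.zero)) (∣tabulate∣-zero (λ i → f (Fin.suc i)) (λ i → e (Fin.suc i))))

∣tabulate∣≡0 : ∀ {k} (f : Fin k → Bool) → ∣ tabulate f ∣ ≡ 0 → ∀ i → f i ≡ false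
∣tabulate∣≡0 {suc k} f z i with f Fin.zero in e0
∣tabulate∣≡0 {suc k} f z Fin.zero | false = e0
∣tabulate∣≡0 {suc k} f z (Fin.suc i) | false = ∣tabulate∣≡0 (λ i → f (Fin.suc i)) z i
∣tabulate∣≡0 {suc k} f () i | true

module Cyclic (n : ℕ) .{{_ : NonZero n}} where

  open +-*-Solver

  infix 4 _≋_

  1≤n : 1 ≤ n
  1≤n = >-nonZero⁻¹ n

  _≋_ : ℕ → ℕ → Set
  a ≋ b = a % n ≡ b % n

  ≋-+ʳ : ∀ {a b} k → a ≋ b → a + k ≋ b + k
  ≋-+ʳ {a} {b} k e = begin
    (a + k) % n         ≡⟨ %-distribˡ-+ a k n ⟩
    (a % n + k % n) % n ≡⟨ cong (λ z → (z + k % n) % n) e ⟩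
    (b % n + k % n) % n ≡⟨ %-distribˡ-+ b k n ⟨
    (b + k) % n         ∎
    where open ≡-Reasoning

  ≋-+ˡ : ∀ {a b} k → a ≋ b → k + a ≋ k + b
  ≋-+ˡ {a} {b} k e = trans (cong (_% n) (+-comm k a)) (trans (≋-+ʳ k e) (cong (_% n) (+-comm b k)))

  +n≋ : ∀ a → a + n ≋ a
  +n≋ a = [m+n]%n≡m%n a n

  %≋ : ∀ a → a % n ≋ a
  %≋ a = m%n%n≡m%n a n

  inverse : ∀ p → p + (n ∸ p % n) ≋ 0
  inverse p = begin
    (p + (n ∸ r)) % n     ≡⟨ cong (λ z → (z + (n ∸ r)) % n) (m≡m%n+[m/n]*n p n) ⟩
    (r + q + (n ∸ r)) % n ≡⟨ cong (_% n) regroup ⟩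
    (n + q) % n           ≡⟨ [m+kn]%n≡m%n n (p / n) n ⟩
    n % n                 ≡⟨ n%n≡0 n ⟩
    0                     ≡⟨ m<n⇒m%n≡m 1≤n ⟨
    0 % n                 ∎
    where
    open ≡-Reasoning
    r q : ℕ
    r = p % n
    q = (p / n) * n
    regroup : r + q + (n ∸ r) ≡ n + q
    regroup = trans (solve 3 (λ r q d → r :+ q :+ d := (r :+ d) :+ q) refl r q (n ∸ r))
                    (cong (_+ q) (m+[n∸m]≡n (m%n≤n p n)))

  ≋-cancelˡ : ∀ p {a b} → p + a ≋ p + b → a ≋ b
  ≋-cancelˡ p {a} {b} e = begin
    a % n             ≡⟨ absorb a ⟨
    (a + (p + k)) % n ≡⟨ cong (_% n) (regroup a) ⟩
    (p + a + k) % n   ≡⟨ ≋-+ʳ k e ⟩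
    (p + b + k) % n   ≡⟨ cong (_% n) (regroup b) ⟨
    (b + (p + k)) % n ≡⟨ absorb b ⟩
    b % n             ∎
    where
    open ≡-Reasoning
    k : ℕ
    k = n ∸ p % n
    absorb : ∀ a → a + (p + k) ≋ a
    absorb a = trans (≋-+ˡ a (inverse p)) (cong (_% n) (+-identityʳ a))
    regroup : ∀ a → a + (p + k) ≡ p + a + k
    regroup a = solve 3 (λ a p k → a :+ (p :+ k) := p :+ a :+ k) refl a p k

  ≋-cancelʳ : ∀ k {a b} → a + k ≋ b + k → a ≋ b
  ≋-cancelʳ k {a} {b} e = ≋-cancelˡ k (trans (cong (_% n) (+-comm k a)) (trans e (cong (_% n) (+-comm b k))))

  ≋-wrap : ∀ {k} → k ≤ n → ∀ a → a + (n ∸ k) + k ≋ a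
  ≋-wrap {k} k≤n a = trans (cong (_% n) (trans (+-assoc a (n ∸ k) k) (cong (a +_) (m∸n+n≡m k≤n)))) (+n≋ a)

  ≋-back : ∀ {k} → k ≤ n → ∀ a j → a + (n ∸ k) + (k + j) ≋ a + j
  ≋-back {k} k≤n a j = trans (cong (_% n) (sym (+-assoc (a + (n ∸ k)) k j))) (≋-+ʳ j (≋-wrap k≤n a))

  ≋⇒≡ : ∀ {a b} → a < n → b < n → a ≋ b → a ≡ b
  ≋⇒≡ {a} {b} a<n b<n e = trans (sym (m<n⇒m%n≡m a<n)) (trans e (m<n⇒m%n≡m b<n))

  shift-≢ : ∀ a d → 0 < d → d < n → ¬ a + d ≋ a
  shift-≢ a d 0<d d<n e with ≋⇒≡ d<n 1≤n (≋-cancelˡ a (trans e (cong (_% n) (sym (+-identityʳ a)))))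
  ... | refl = <-irrefl refl 0<d

  toℕ-vtx≋ : ∀ a → toℕ (vtx n a) ≋ a
  toℕ-vtx≋ a = trans (cong (_% n) (toℕ-fromℕ< (m%n<n a n))) (%≋ a)

  vtx-cong : ∀ {a b} → a ≋ b → vtx n a ≡ vtx n b
  vtx-cong {a} {b} e = fromℕ<-cong (a % n) (b % n) e (m%n<n a n) (m%n<n b n)

  vtx-inj : ∀ {a b} → vtx n a ≡ vtx n b → a ≋ b
  vtx-inj {a} {b} e = trans (sym (toℕ-vtx≋ a)) (trans (cong (λ v → toℕ v % n) e) (toℕ-vtx≋ b))

  vtx-toℕ : ∀ (v : Fin n) → vtx n (toℕ v) ≡ v
  vtx-toℕ v = toℕ-injective (trans (toℕ-fromℕ< (m%n<n (toℕ v) n)) (m<n⇒m%n≡m (toℕ<n v)))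

  toℕ-≋ : ∀ {a j} → vtx n a ≡ j → toℕ j ≋ a
  toℕ-≋ {a} e = trans (cong (λ v → toℕ v % n) (sym e)) (toℕ-vtx≋ a)

  memB-cong : ∀ (S : Subset n) {a b} → a ≋ b → memB n S a ≡ memB n S b
  memB-cong S e = cong (lookup S) (vtx-cong e)

  ∈⇒memB : ∀ {S : Subset n} {u a} → u ∈ S → u ≡ vtx n a → memB n S a ≡ true
  ∈⇒memB {S} u∈S refl = []=⇒lookup u∈S

  adj-cases : ∀ {v u} → Adj n v u → u ≡ vtx n (toℕ v + 1) ⊎ u ≡ vtx n (toℕ v + (n ∸ 1))
  adj-cases (inj₁ e) = inj₁ e
  adj-cases {v} {u} (inj₂ e) = inj₂ (trans (sym (vtx-toℕ u)) (vtx-cong (sym back)))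
    where
    back : toℕ v + (n ∸ 1) ≋ toℕ u
    back = begin
      (toℕ v + (n ∸ 1)) % n     ≡⟨ ≋-+ʳ (n ∸ 1) (trans (cong (λ w → toℕ w % n) e) (toℕ-vtx≋ (toℕ u + 1))) ⟩
      (toℕ u + 1 + (n ∸ 1)) % n ≡⟨ cong (_% n) (solve 3 (λ a b c → a :+ b :+ c := a :+ c :+ b) refl (toℕ u) 1 (n ∸ 1)) ⟩
      (toℕ u + (n ∸ 1) + 1) % n ≡⟨ ≋-wrap 1≤n (toℕ u) ⟩
      toℕ u % n                 ∎
      where open ≡-Reasoning

  Everywhere : Pattern → Subset n → Set
  Everywhere P S = ∀ x → holds P (memB n S) x ≡ true

  holds-≋ : ∀ P (S : Subset n) {a b} → a ≋ b → holds P (memB n S) a ≡ holds P (memB n S) b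
  holds-≋ P S {a} {b} e = holds-cong P (memB n S) (memB n S) a b (λ j _ → memB-cong S (≋-+ʳ j e))

  tds⇒dominating : ∀ S → IsTDS n S → Everywhere dominatesNext S
  tds⇒dominating S tds x with tds (vtx n (x + 1))
  ... | u , adj , u∈S with adj-cases adj
  ...   | inj₁ e = ∨-introʳ (memB n S x) (∈⇒memB u∈S (trans e (vtx-cong forward)))
    where
    forward : toℕ (vtx n (x + 1)) + 1 ≋ x + 2
    forward = trans (≋-+ʳ 1 (toℕ-vtx≋ (x + 1))) (cong (_% n) (+-assoc x 1 1))
  ...   | inj₂ e = ∨-introˡ (memB n S (x + 2)) (∈⇒memB u∈S (trans e (vtx-cong backward)))
    where
    backward : toℕ (vtx n (x + 1)) + (n ∸ 1) ≋ x
    backward = trans (≋-+ʳ (n ∸ 1) (toℕ-vtx≋ (x + 1)))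
                     (trans (cong (_% n) (solve 3 (λ a b c → a :+ b :+ c := a :+ c :+ b) refl x 1 (n ∸ 1))) (≋-wrap 1≤n x))

  dominating⇒tds : ∀ S → Everywhere dominatesNext S → IsTDS n S
  dominating⇒tds S D v with ∨-split (D (toℕ v + (n ∸ 1)))
  ... | inj₂ e = vtx n (toℕ v + 1) , inj₁ refl , lookup⇒[]= _ S (trans (memB-cong S (sym (≋-back 1≤n (toℕ v) 1))) e)
  ... | inj₁ e = vtx n (toℕ v + (n ∸ 1)) , inj₂ (sym (trans (vtx-cong forward) (vtx-toℕ v))) , lookup⇒[]= _ S e
    where
    forward : toℕ (vtx n (toℕ v + (n ∸ 1))) + 1 ≋ toℕ v
    forward = trans (≋-+ʳ 1 (toℕ-vtx≋ (toℕ v + (n ∸ 1)))) (≋-wrap 1≤n (toℕ v))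

  -- In a minimal TDS no v_x, v_{x+2}, v_{x+4} all lie in S: otherwise S - v_{x+2} is a smaller TDS.
  minimal⇒irredundant : 3 ≤ n → ∀ S → IsMTDS n S → Everywhere irredundant S
  minimal⇒irredundant 3≤n S (tds , minimal) x
    with memB n S x in e0 | memB n S (x + 2) in e2 | memB n S (x + 4) in e4
  ... | false | _ | _ = refl
  ... | true | false | _ = refl
  ... | true | true | false = refl
  ... | true | true | true = ⊥-elim (minimal T (toggle-⊂ S u e2) (dominating⇒tds T dominatingT))
    where
    u : Fin n
    u = vtx n (x + 2)
    T : Subset n
    T = toggle S u
    D : Everywhere dominatesNext S
    D = tds⇒dominating S tds
    unchanged : ∀ a → ¬ vtx n a ≡ u → memB n T a ≡ memB n S a
    unchanged a ne = lookup∘updateAt′ (vtx n a) u ne S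
    dominatingT : Everywhere dominatesNext T
    dominatingT y with vtx n y ≟ᶠ u
    ... | yes y≡u = ∨-introʳ (memB n T y) (trans (unchanged (y + 2) moved) (trans (memB-cong S y+2≋x+4) e4))
      where
      y+2≋x+4 : y + 2 ≋ x + 4
      y+2≋x+4 = trans (≋-+ʳ 2 (vtx-inj y≡u)) (cong (_% n) (+-assoc x 2 2))
      moved : ¬ vtx n (y + 2) ≡ u
      moved e = shift-≢ (x + 2) 2 (s≤s z≤n) 3≤n
                  (trans (cong (_% n) (+-assoc x 2 2)) (trans (sym y+2≋x+4) (vtx-inj e)))
    ... | no y≢u with vtx n (y + 2) ≟ᶠ u
    ...   | yes y+2≡u = ∨-introˡ (memB n T (y + 2)) (trans (unchanged y y≢u) (trans (memB-cong S (≋-cancelʳ 2 (vtx-inj y+2≡u))) e0))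
    ...   | no y+2≢u = subst₂ (λ a b → a ∨ b ≡ true) (sym (unchanged y y≢u)) (sym (unchanged (y + 2) y+2≢u)) (D y)

  -- Conversely a dominating, irredundant S is a minimal TDS: a TDS T ⊂ S missing v would force
  -- v_{v-2}, v and v_{v+2} into S.
  irredundant⇒minimal : 2 ≤ n → ∀ S → Everywhere dominatesNext S → Everywhere irredundant S → IsMTDS n S
  irredundant⇒minimal 2≤n S D I = dominating⇒tds S D , λ T T⊂S tdsT → noSmaller T T⊂S (tds⇒dominating T tdsT)
    where
    noSmaller : ∀ T → T ⊂ S → Everywhere dominatesNext T → ⊥
    noSmaller T (T⊆S , v , v∈S , v∉T) DT = true≢false (I a) (cong not (∧-intro inLeft (∧-intro inMid inRight)))
      where
      m a : ℕ
      m = toℕ v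
      a = m + (n ∸ 2)
      a+2≋m : a + 2 ≋ m
      a+2≋m = ≋-wrap 2≤n m
      missing : ∀ {y} → y ≋ m → memB n T y ≡ false
      missing {y} e with memB n T y in ey
      ... | false = refl
      ... | true = ⊥-elim (v∉T (subst (_∈ T) (trans (vtx-cong e) (vtx-toℕ v)) (lookup⇒[]= _ T ey)))
      fromT : ∀ y → memB n T y ≡ true → memB n S y ≡ true
      fromT y e = []=⇒lookup (T⊆S (lookup⇒[]= _ T e))
      otherSide : ∀ {y z} → memB n T y ≡ false → memB n T y ∨ memB n T z ≡ true → memB n S z ≡ true
      otherSide {y} {z} f e with ∨-split e
      ... | inj₁ t = true≢false t f
      ... | inj₂ t = fromT z t
      inMid : memB n S (a + 2) ≡ true
      inMid = trans (memB-cong S a+2≋m) (∈⇒memB v∈S (sym (vtx-toℕ v)))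
      inRight : memB n S (a + 4) ≡ true
      inRight = trans (memB-cong S (≋-back 2≤n m 2)) (otherSide (missing refl) (DT m))
      inLeft : memB n S a ≡ true
      inLeft with ∨-split (DT a)
      ... | inj₁ t = fromT a t
      ... | inj₂ t = true≢false t (missing a+2≋m)

  view : Subset n → ℕ → ℕ → Bool
  view T p y = memB n T (p + y)

  holds-view : ∀ P T p x → holds P (view T p) x ≡ holds P (memB n T) (p + x)
  holds-view P T p x = holds-cong P (view T p) (memB n T) x (p + x) (λ j _ → cong (memB n T) (sym (+-assoc p x j)))

  reach : ∀ p x → ∃[ r ] (r < n × p + r ≋ x)
  reach p x = (x + k) % n , m%n<n (x + k) n , reaches
    where
    k : ℕ
    k = n ∸ p % n
    reaches : p + (x + k) % n ≋ x
    reaches = begin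
      (p + (x + k) % n) % n ≡⟨ ≋-+ˡ p (%≋ (x + k)) ⟩
      (p + (x + k)) % n     ≡⟨ cong (_% n) (solve 3 (λ p x k → p :+ (x :+ k) := x :+ (p :+ k)) refl p x k) ⟩
      (x + (p + k)) % n     ≡⟨ ≋-+ˡ x (inverse p) ⟩
      (x + 0) % n           ≡⟨ cong (_% n) (+-identityʳ x) ⟩
      x % n                 ∎
      where open ≡-Reasoning

  μ : Pattern → Subset n → ℕ
  μ P T = sumBelow n (λ x → bit (holds P (memB n T) x))

  μ-view : ∀ P T p → sumBelow n (λ x → bit (holds P (view T p) x)) ≡ μ P T
  μ-view P T p =
    trans (sumBelow-cong n (λ x _ → cong bit (holds-view P T p x)))
          (sumBelow-rotate n (λ z → bit (holds P (memB n T) z)) (λ i → cong bit (holds-≋ P T (+n≋ i))) p)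

  μ≡0 : ∀ P T → μ P T ≡ 0 → ∀ x → holds P (memB n T) x ≡ false
  μ≡0 P T z x = trans (holds-≋ P T (sym (%≋ x))) (bit≡0 (sumBelow-zero n _ z (x % n) (m%n<n x n)))
    where
    bit≡0 : ∀ {b} → bit b ≡ 0 → b ≡ false
    bit≡0 {false} _ = refl

  μ≢0 : ∀ P T → ¬ μ P T ≡ 0 → ∃[ x ] holds P (memB n T) x ≡ true
  μ≢0 P T nz with sumBelow-nonzero n _ nz
  ... | x , hx = x , bit≢0 hx
    where
    bit≢0 : ∀ {b} → ¬ bit b ≡ 0 → b ≡ true
    bit≢0 {true} _ = refl
    bit≢0 {false} ne = ⊥-elim (ne refl)

  -- Local surgery on a window. The window of S at p consists of the vertices v_p, ..., v_{p+m+3};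
  -- the flippable zone is [4, m), so S is untouched within distance 4 of the window's outside.
  module Window (S : Subset n) (p m : ℕ) (4≤m : 4 ≤ m) (m≤n : m ≤ n) where

    Margin : ℕ → Set
    Margin y = y < 4 ⊎ m ≤ y

    record Tracks (T : Subset n) (u : Word) : Set where
      field
        inWindow : ∀ x → x < m + 4 → view T p x ≡ at u x
        offZone : ∀ y → y < n → Margin y → view T p y ≡ view S p y

    open Tracks

    w₀ : Word
    w₀ = read (view S p) (m + 4)

    tracks-start : Tracks S w₀
    tracks-start = record { inWindow = λ x lt → sym (at-read (view S p) (m + 4) x lt) ; offZone = λ _ _ _ → refl }

    wrapped : ∀ {x} → x < n + 4 → x < n ⊎ ∃[ y ] (x ≡ y + n × y < 4)
    wrapped {x} lt with x <? n
    ... | yes x<n = inj₁ x<n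
    ... | no x≮n = inj₂ (x ∸ n , sym (m∸n+n≡m (≮⇒≥ x≮n)) ,
                         +-cancelʳ-< n (x ∸ n) 4 (subst (_< 4 + n) (sym (m∸n+n≡m (≮⇒≥ x≮n))) (subst (x <_) (+-comm n 4) lt)))

    4≤n : 4 ≤ n
    4≤n = ≤-trans 4≤m m≤n

    window-≢ : ∀ {x c} → x < m + 4 → ¬ x ≡ c → 4 ≤ c → c < m → ¬ vtx n (p + x) ≡ vtx n (p + c)
    window-≢ {x} {c} x<m+4 x≢c 4≤c c<m e with wrapped (≤-trans x<m+4 (+-monoˡ-≤ 4 m≤n))
    ... | inj₁ x<n = x≢c (≋⇒≡ x<n (≤-trans c<m m≤n) (≋-cancelˡ p (vtx-inj e)))
    ... | inj₂ (y , refl , y<4) = <-irrefl refl (≤-trans (subst (_< 4) y≡c y<4) 4≤c)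
      where
      y≡c : y ≡ c
      y≡c = ≋⇒≡ (<-≤-trans y<4 4≤n) (≤-trans c<m m≤n) (trans (sym (+n≋ y)) (≋-cancelˡ p (vtx-inj e)))

    margin-≢ : ∀ {y c} → y < n → Margin y → 4 ≤ c → c < m → ¬ vtx n (p + y) ≡ vtx n (p + c)
    margin-≢ {y} {c} y<n margin 4≤c c<m e with ≋⇒≡ y<n (≤-trans c<m m≤n) (≋-cancelˡ p (vtx-inj e)) | margin
    ... | refl | inj₁ c<4 = <-irrefl refl (≤-trans c<4 4≤c)
    ... | refl | inj₂ m≤c = <-irrefl refl (≤-trans c<m m≤c)

    tracks-flip : ∀ {T u c} → Tracks T u → length u ≡ m + 4 → 4 ≤ c → c < m →
                  Tracks (toggle T (vtx n (p + c))) (flipAt u c)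
    tracks-flip {T} {u} {c} tr len 4≤c c<m = record { inWindow = inWindow′ ; offZone = offZone′ }
      where
      xv = vtx n (p + c)
      c<m+4 : c < m + 4
      c<m+4 = ≤-trans c<m (m≤m+n m 4)
      inWindow′ : ∀ x → x < m + 4 → view (toggle T xv) p x ≡ at (flipAt u c) x
      inWindow′ x x<m+4 with x ≟ℕ c
      ... | yes refl = trans (lookup∘updateAt xv T)
                             (trans (cong not (inWindow tr c x<m+4)) (sym (at-flipAt-same u c (subst (c <_) (sym len) c<m+4))))
      ... | no x≢c = trans (lookup∘updateAt′ (vtx n (p + x)) xv (window-≢ x<m+4 x≢c 4≤c c<m) T)
                           (trans (inWindow tr x x<m+4) (sym (at-flipAt-other u c x x≢c)))
      offZone′ : ∀ y → y < n → Margin y → view (toggle T xv) p y ≡ view S p y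
      offZone′ y y<n margin = trans (lookup∘updateAt′ (vtx n (p + y)) xv (margin-≢ y<n margin 4≤c c<m) T) (offZone tr y y<n margin)

    tracks-beyond : ∀ {T u} → Tracks T u → ∀ z → m ≤ z → z < n + 4 → view T p z ≡ view S p z
    tracks-beyond {T} tr z m≤z z<n+4 with wrapped z<n+4
    ... | inj₁ z<n = offZone tr z z<n (inj₂ m≤z)
    ... | inj₂ (y , refl , y<4) = begin
      memB n T (p + (y + n)) ≡⟨ memB-cong T (around y) ⟩
      memB n T (p + y)       ≡⟨ offZone tr y (<-≤-trans y<4 4≤n) (inj₁ y<4) ⟩
      memB n S (p + y)       ≡⟨ memB-cong S (around y) ⟨
      memB n S (p + (y + n)) ∎
      where
      open ≡-Reasoning
      around : ∀ y → p + (y + n) ≋ p + y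
      around y = trans (cong (_% n) (sym (+-assoc p y n))) (+n≋ (p + y))

    tracks-everywhere : ∀ {T u} → Tracks T u → ∀ P → allBelow m (holds P (at u)) ≡ true → Everywhere P S → Everywhere P T
    tracks-everywhere {T} {u} tr P onWindow onS x with reach p x
    ... | r , r<n , p+r≋x = trans (holds-≋ P T (sym p+r≋x)) (trans (sym (holds-view P T p r)) local)
      where
      local : holds P (view T p) r ≡ true
      local with r <? m
      ... | yes r<m = trans (holds-cong P (view T p) (at u) r r (λ j j≤4 → inWindow tr (r + j) (+-mono-<-≤ r<m j≤4)))
                            (allBelow-elim m _ onWindow r r<m)
      ... | no r≮m = trans (holds-cong P (view T p) (view S p) r r
                              (λ j j≤4 → tracks-beyond tr (r + j) (≤-trans (≮⇒≥ r≮m) (m≤m+n r j)) (+-mono-<-≤ r<n j≤4)))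
                           (trans (holds-view P S p r) (onS (p + r)))

    -- the part of the measure lying beyond the window, which no flip changes
    rest : Pattern → ℕ
    rest P = sumBelow (n ∸ m) (λ i → bit (holds P (view S p) (m + i)))

    tracks-measure : ∀ {T u} → Tracks T u → ∀ P → μ P T ≡ countIn P m u + rest P
    tracks-measure {T} {u} tr P = begin
      μ P T                                             ≡⟨ μ-view P T p ⟨
      sumBelow n h                                      ≡⟨ cong (λ k → sumBelow k h) (m+[n∸m]≡n m≤n) ⟨
      sumBelow (m + (n ∸ m)) h                          ≡⟨ sumBelow-split m (n ∸ m) h ⟩
      sumBelow m h + sumBelow (n ∸ m) (λ i → h (m + i)) ≡⟨ cong₂ _+_ (sumBelow-cong m inside) (sumBelow-cong (n ∸ m) beyond) ⟩
      countIn P m u + rest P                            ∎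
      where
      open ≡-Reasoning
      h : ℕ → ℕ
      h x = bit (holds P (view T p) x)
      inside : ∀ i → i < m → h i ≡ bit (holds P (at u) i)
      inside i i<m = cong bit (holds-cong P (view T p) (at u) i i (λ j j≤4 → inWindow tr (i + j) (+-mono-<-≤ i<m j≤4)))
      beyond : ∀ i → i < n ∸ m → h (m + i) ≡ bit (holds P (view S p) (m + i))
      beyond i i<n∸m = cong bit (holds-cong P (view T p) (view S p) (m + i) (m + i)
                         (λ j j≤4 → tracks-beyond tr (m + i + j) (≤-trans (m≤m+n m i) (m≤m+n _ j)) (+-mono-<-≤ m+i<n j≤4)))
        where
        m+i<n : m + i < n
        m+i<n = subst (m + i <_) (m+[n∸m]≡n m≤n) (+-monoʳ-< m i<n∸m)

    μ-decreases : ∀ {T u} → Tracks T u → ∀ P → countIn P m u < countIn P m w₀ → μ P T < μ P S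
    μ-decreases tr P lt = subst₂ _<_ (sym (tracks-measure tr P)) (sym (tracks-measure tracks-start P)) (+-monoˡ-< (rest P) lt)

    record Reached (T : Subset n) (u : Word) : Set where
      field
        tracks : Tracks T u
        length≡ : length u ≡ m + 4
        dominating : Everywhere dominatesNext T
        balance : ∣ T ∣ + weight w₀ ≡ ∣ S ∣ + weight u

    open Reached

    start : Everywhere dominatesNext S → Reached S w₀
    start domS = record { tracks = tracks-start ; length≡ = length-read (view S p) (m + 4) ; dominating = domS ; balance = refl }

    step : ∀ {T u c} → Reached T u → 4 ≤ c → c < m → Everywhere dominatesNext S →
           allBelow m (holds dominatesNext (at (flipAt u c))) ≡ true →
           Reached (toggle T (vtx n (p + c))) (flipAt u c)
           × (AddOne T (toggle T (vtx n (p + c))) ⊎ AddOne (toggle T (vtx n (p + c))) T)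
    step {T} {u} {c} r 4≤c c<m domS domU = byBit (at u c) refl
      where
      xv : Fin n
      xv = vtx n (p + c)
      T′ : Subset n
      T′ = toggle T xv
      u′ : Word
      u′ = flipAt u c
      c<m+4 : c < m + 4
      c<m+4 = ≤-trans c<m (m≤m+n m 4)
      c<len : c < length u
      c<len = subst (c <_) (sym (length≡ r)) c<m+4
      look : ∀ {b} → at u c ≡ b → lookup T xv ≡ b
      look e = trans (inWindow (tracks r) c c<m+4) e
      tracks′ : Tracks T′ u′
      tracks′ = tracks-flip (tracks r) (length≡ r) 4≤c c<m
      reached : ∣ T′ ∣ + weight w₀ ≡ ∣ S ∣ + weight u′ → Reached T′ u′
      reached bal = record { tracks = tracks′ ; length≡ = trans (length-flipAt u c) (length≡ r)
                           ; dominating = tracks-everywhere tracks′ dominatesNext domU domS ; balance = bal }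
      open ≡-Reasoning
      byBit : ∀ b → at u c ≡ b → Reached T′ u′ × (AddOne T T′ ⊎ AddOne T′ T)
      byBit false e = reached up , inj₁ (xv , false⇒∉ (look e) , toggle-add T xv (look e))
        where
        up : ∣ T′ ∣ + weight w₀ ≡ ∣ S ∣ + weight u′
        up = begin
          ∣ T′ ∣ + weight w₀      ≡⟨ cong (_+ weight w₀) (∣toggle∣-add T xv (look e)) ⟩
          suc (∣ T ∣ + weight w₀) ≡⟨ cong suc (balance r) ⟩
          suc (∣ S ∣ + weight u)  ≡⟨ +-suc ∣ S ∣ (weight u) ⟨
          ∣ S ∣ + suc (weight u)  ≡⟨ cong (∣ S ∣ +_) (weight-flipAt-up u c c<len e) ⟨
          ∣ S ∣ + weight u′       ∎
      byBit true e = reached down ,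
                     inj₂ (xv , false⇒∉ (trans (lookup∘updateAt xv T) (cong not (look e))) , sym (toggle-remove T xv (look e)))
        where
        down : ∣ T′ ∣ + weight w₀ ≡ ∣ S ∣ + weight u′
        down = suc-injective (begin
          suc (∣ T′ ∣ + weight w₀) ≡⟨ cong (_+ weight w₀) (∣toggle∣-remove T xv (look e)) ⟨
          ∣ T ∣ + weight w₀        ≡⟨ balance r ⟩
          ∣ S ∣ + weight u         ≡⟨ cong (∣ S ∣ +_) (weight-flipAt-down u c c<len e) ⟩
          ∣ S ∣ + suc (weight u′)  ≡⟨ +-suc ∣ S ∣ (weight u′) ⟩
          suc (∣ S ∣ + weight u′)  ∎)

    applyFlips : Subset n → List ℕ → Subset n
    applyFlips T [] = T
    applyFlips T (c ∷ cs) = applyFlips (toggle T (vtx n (p + c))) cs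

    walk : ∀ K B → ∣ S ∣ + B ≤ K + weight w₀ → Everywhere dominatesNext S →
           ∀ cs {T u} → Reached T u → ∣ T ∣ ≤ K → validFlips m B u cs ≡ true →
           Star (DStep n K) T (applyFlips T cs) × Reached (applyFlips T cs) (flipAll u cs)
    walk K B bound domS [] r T≤K _ = ε , r
    walk K B bound domS (c ∷ cs) {T} {u} r T≤K ok with validFlips-head {m} {B} {u} {c} {cs} ok
    ... | 4≤c , c<m , domU , weight≤B , ok′ = edge ◅ proj₁ later , proj₂ later
      where
      T′ : Subset n
      T′ = toggle T (vtx n (p + c))
      next : Reached T′ (flipAt u c) × (AddOne T T′ ⊎ AddOne T′ T)
      next = step r 4≤c c<m domS domU
      r′ : Reached T′ (flipAt u c)
      r′ = proj₁ next
      T′≤K : ∣ T′ ∣ ≤ K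
      T′≤K = +-cancelʳ-≤ (weight w₀) _ K (begin
        ∣ T′ ∣ + weight w₀                       ≡⟨ balance r′ ⟩
        ∣ S ∣ + weight (flipAt u c)              ≤⟨ +-monoʳ-≤ ∣ S ∣ weight≤B ⟩
        ∣ S ∣ + B                                ≤⟨ bound ⟩
        K + weight w₀                            ∎)
        where open ≤-Reasoning
      edge : DStep n K T T′
      edge = dominating⇒tds T (dominating r) , dominating⇒tds T′ (dominating r′) , T≤K , T′≤K , proj₂ next
      later : Star (DStep n K) T′ (applyFlips T′ cs) × Reached (applyFlips T′ cs) (flipAll (flipAt u c) cs)
      later = walk K B bound domS cs r′ T′≤K ok′

    improve : IsMTDS n S → ∀ P B K cs → improves m B P w₀ cs ≡ true →
              ∣ S ∣ + B ≤ K + weight w₀ → ∣ S ∣ ≤ K →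
              IsMTDS n (applyFlips S cs) × SameComp n K S (applyFlips S cs)
              × μ P (applyFlips S cs) < μ P S × Reached (applyFlips S cs) (flipAll w₀ cs)
    improve mS P B K cs ok bound S≤K with ∧-split ok
    ... | valid , ok′ with ∧-split ok′
    ... | irr , fewer = minimal , proj₁ walked , μ-decreases (tracks r) P (≤ᵇ-sound fewer) , r
      where
      3≤n : 3 ≤ n
      3≤n = ≤-trans (n≤1+n 3) 4≤n
      domS : Everywhere dominatesNext S
      domS = tds⇒dominating S (proj₁ mS)
      walked : Star (DStep n K) S (applyFlips S cs) × Reached (applyFlips S cs) (flipAll w₀ cs)
      walked = walk K B bound domS cs (start domS) S≤K valid
      r : Reached (applyFlips S cs) (flipAll w₀ cs)
      r = proj₂ walked
      minimal : IsMTDS n (applyFlips S cs)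
      minimal = irredundant⇒minimal (≤-trans (n≤1+n 2) 3≤n) _ (dominating r)
                  (tracks-everywhere (tracks r) irredundant irr (minimal⇒irredundant 3≤n S mS))

  everywhere-view : ∀ P T → Everywhere P T → ∀ p y → holds P (view T p) y ≡ true
  everywhere-view P T all p y = trans (holds-view P T p y) (all (p + y))

  read-anchor : ∀ P T p L k {x} → k + 4 < L → p + k ≋ x → holds P (memB n T) x ≡ true →
                holds P (at (read (view T p) L)) k ≡ true
  read-anchor P T p L k k+4<L p+k≋x h =
    trans (holds-read P (view T p) L k k+4<L) (trans (holds-view P T p k) (trans (holds-≋ P T p+k≋x) h))

  redundant : ∀ S a → Everywhere irredundant S → memB n S a ≡ true → memB n S (a + 2) ≡ true → memB n S (a + 4) ≡ true → ⊥
  redundant S a I ea ec ee = true≢false (I a) (cong not (∧-intro ea (∧-intro ec ee)))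

  runB≡allBelow : ∀ S i k → runB n S i k ≡ allBelow k (λ j → memB n S (i + j))
  runB≡allBelow S i zero = refl
  runB≡allBelow S i (suc k) = cong (memB n S (i + k) ∧_) (runB≡allBelow S i k)

  component-parts : ∀ k S v → compB n k S v ≡ true →
    memB n S (toℕ v + (n ∸ 1)) ≡ false × runB n S (toℕ v) k ≡ true × memB n S (toℕ v + k) ≡ false
  component-parts k S v e with memB n S (toℕ v + (n ∸ 1)) | runB n S (toℕ v) k | memB n S (toℕ v + k)
  component-parts k S v e | false | true | false = refl , refl , refl
  component-parts k S v () | true | _ | _
  component-parts k S v () | false | false | _
  component-parts k S v () | false | true | true

  component-run : ∀ k S v → compB n k S v ≡ true → ∀ j → j < k → memB n S (toℕ v + j) ≡ true
  component-run k S v e = allBelow-elim k _ (trans (sym (runB≡allBelow S (toℕ v) k)) (proj₁ (proj₂ (component-parts k S v e))))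

  component-intro : ∀ k S v → memB n S (toℕ v + (n ∸ 1)) ≡ false → (∀ j → j < k → memB n S (toℕ v + j) ≡ true) →
                    memB n S (toℕ v + k) ≡ false → compB n k S v ≡ true
  component-intro k S v before run after
    rewrite before | runB≡allBelow S (toℕ v) k | allBelow-intro k _ run | after = refl

  memB-at : ∀ S {a j} → vtx n a ≡ j → ∀ k → memB n S (toℕ j + k) ≡ memB n S (a + k)
  memB-at S e k = memB-cong S (≋-+ʳ k (toℕ-≋ e))

  compB3≡p3Component : ∀ S v → compB n 3 S v ≡ holds p3Component (memB n S) (toℕ v + (n ∸ 1))
  compB3≡p3Component S v
    rewrite memB-cong S (≋-back 1≤n (toℕ v) 0) | memB-cong S (≋-back 1≤n (toℕ v) 1)
          | memB-cong S (≋-back 1≤n (toℕ v) 2) | memB-cong S (≋-back 1≤n (toℕ v) 3) = refl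

  countComp3≡μ : ∀ S → countComp n 3 S ≡ μ p3Component S
  countComp3≡μ S = begin
    countComp n 3 S                                          ≡⟨ ∣tabulate∣ (compB n 3 S) (λ i → h (i + (n ∸ 1))) (λ v → cong bit (sym (compB3≡p3Component S v))) ⟩
    sumBelow n (λ i → h (i + (n ∸ 1)))                       ≡⟨ sumBelow-cong n (λ i _ → cong h (+-comm i (n ∸ 1))) ⟩
    sumBelow n (λ i → h ((n ∸ 1) + i))                       ≡⟨ sumBelow-rotate n h (λ i → cong bit (holds-≋ p3Component S (+n≋ i))) (n ∸ 1) ⟩
    μ p3Component S                                          ∎
    where
    open ≡-Reasoning
    h : ℕ → ℕ
    h z = bit (holds p3Component (memB n S) z)

  -- a P_k component starts with a run of k; so if the run pattern P never occurs, there is no P_k component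
  countComp≡0 : ∀ k P S → (∀ x → (∀ j → j < k → memB n S (x + j) ≡ true) → holds P (memB n S) x ≡ true) →
                μ P S ≡ 0 → countComp n k S ≡ 0
  countComp≡0 k P S run none = ∣tabulate∣-zero (compB n k S)
    (λ v → ¬true⇒false (λ e → true≢false (run (toℕ v) (component-run k S v e)) (μ≡0 P S none (toℕ v))))

  run4-intro : ∀ S x → (∀ j → j < 4 → memB n S (x + j) ≡ true) → holds run4 (memB n S) x ≡ true
  run4-intro S x r = ∧-intro (trans (cong (memB n S) (sym (+-identityʳ x))) (r 0 (s≤s z≤n)))
                       (∧-intro (r 1 (s≤s (s≤s z≤n))) (∧-intro (r 2 (s≤s (s≤s (s≤s z≤n)))) (r 3 ≤-refl)))

  run3-intro : ∀ S x → (∀ j → j < 3 → memB n S (x + j) ≡ true) → holds run3 (memB n S) x ≡ true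
  run3-intro S x r = ∧-intro (trans (cong (memB n S) (sym (+-identityʳ x))) (r 0 (s≤s z≤n)))
                       (∧-intro (r 1 (s≤s (s≤s z≤n))) (r 2 ≤-refl))

  run4-elim : ∀ S x → holds run4 (memB n S) x ≡ true → ∀ j → j < 4 → memB n S (x + j) ≡ true
  run4-elim S x e j j<4 = pick j j<4 (memB n S x) (memB n S (x + 1)) (memB n S (x + 2)) (memB n S (x + 3)) (cong (memB n S) (+-identityʳ x)) refl refl refl e
    where
    pick : ∀ j → j < 4 → ∀ a b c d → memB n S (x + 0) ≡ a → memB n S (x + 1) ≡ b → memB n S (x + 2) ≡ c → memB n S (x + 3) ≡ d →
           a ∧ (b ∧ (c ∧ d)) ≡ true → memB n S (x + j) ≡ true
    pick 0 _ true true true true e0 _ _ _ _ = e0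
    pick 1 _ true true true true _ e1 _ _ _ = e1
    pick 2 _ true true true true _ _ e2 _ _ = e2
    pick 3 _ true true true true _ _ _ e3 _ = e3
    pick (suc (suc (suc (suc _)))) (s≤s (s≤s (s≤s (s≤s ())))) _ _ _ _ _ _ _ _ _

  -- In a minimal TDS every run of four is a P_4 component; so without P_4 components there
  -- is no run of four at all.
  noP4⇒noRun4 : ∀ S → IsMTDS n S → 3 ≤ n → countComp n 4 S ≡ 0 → Everywhere noRun4 S
  noP4⇒noRun4 S mS 3≤n none x with holds run4 (memB n S) x in e
  ... | false = refl
  ... | true = true≢false isComponent (∣tabulate∣≡0 (compB n 4 S) none (vtx n x))
    where
    I : Everywhere irredundant S
    I = minimal⇒irredundant 3≤n S mS
    run : ∀ j → j < 4 → memB n S (x + j) ≡ true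
    run = run4-elim S x e
    at-x : ∀ k → memB n S (toℕ (vtx n x) + k) ≡ memB n S (x + k)
    at-x = memB-at S refl
    before : memB n S (x + (n ∸ 1)) ≡ false
    before = ¬true⇒false (λ b → redundant S (x + (n ∸ 1)) I b (trans (memB-cong S (≋-back 1≤n x 1)) (run 1 (s≤s (s≤s z≤n))))
                                                (trans (memB-cong S (≋-back 1≤n x 3)) (run 3 ≤-refl)))
    after : memB n S (x + 4) ≡ false
    after = ¬true⇒false (redundant S x I (trans (cong (memB n S) (sym (+-identityʳ x))) (run 0 (s≤s z≤n))) (run 2 (s≤s (s≤s (s≤s z≤n)))))
    isComponent : compB n 4 S (vtx n x) ≡ true
    isComponent = component-intro 4 S (vtx n x) (trans (at-x (n ∸ 1)) before) (λ j j<4 → trans (at-x j) (run j j<4)) (trans (at-x 4) after)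

sizes-within : ∀ {s t g w u} → s ≤ g → t ≤ g → t + w ≡ s + u → s + ((w ⊔ u) + 1) ≤ (g + 1) + w
sizes-within {s} {t} {g} {w} {u} s≤g t≤g balanced = begin
  s + ((w ⊔ u) + 1)       ≡⟨ +-assoc s _ 1 ⟨
  s + (w ⊔ u) + 1         ≡⟨ cong (_+ 1) (+-distribˡ-⊔ s w u) ⟩
  ((s + w) ⊔ (s + u)) + 1 ≤⟨ +-monoˡ-≤ 1 (⊔-lub (+-monoˡ-≤ w s≤g) (≤-trans (≤-reflexive (sym balanced)) (+-monoˡ-≤ w t≤g))) ⟩
  g + w + 1               ≡⟨ solve 2 (λ g w → g :+ w :+ con 1 := g :+ con 1 :+ w) refl g w ⟩
  g + 1 + w               ∎
  where
  open ≤-Reasoning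
  open +-*-Solver

-- The three reductions, for n ≥ 10 so that windows of length 14 fit on the cycle.
module Reductions (n : ℕ) .{{_ : NonZero n}} (10≤n : 10 ≤ n) where

  open Cyclic n
  open +-*-Solver

  ≤n : ∀ {k} → k ≤ 10 → k ≤ n
  ≤n k≤10 = ≤-trans k≤10 10≤n

  3≤n : 3 ≤ n
  3≤n = ≤n (m≤m+n 3 7)

  local-minimal : ∀ S → IsMTDS n S → ∀ p y → holds minimalTDS (view S p) y ≡ true
  local-minimal S mS p y = ∧-intro (everywhere-view dominatesNext S (tds⇒dominating S (proj₁ mS)) p y)
                                   (everywhere-view irredundant S (minimal⇒irredundant 3≤n S mS) p y)

  local-minimalNoRun4 : ∀ S → IsMTDS n S → Everywhere noRun4 S → ∀ p y → holds minimalTDSnoRun4 (view S p) y ≡ true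
  local-minimalNoRun4 S mS noRun4S p y =
    ∧-intro (everywhere-view dominatesNext S (tds⇒dominating S (proj₁ mS)) p y)
            (∧-intro (everywhere-view irredundant S (minimal⇒irredundant 3≤n S mS) p y) (everywhere-view noRun4 S noRun4S p y))

  descend : ∀ K (Good : Subset n → Set) (ν : Subset n → ℕ) →
            (∀ S → Good S → ¬ ν S ≡ 0 → ∃[ T ] (Good T × SameComp n K S T × ν T < ν S)) →
            ∀ S → Good S → ∃[ T ] (Good T × ν T ≡ 0 × SameComp n K S T)
  descend K Good ν reduce S good = go S (<-wellFounded (ν S)) good
    where
    go : ∀ S → Acc _<_ (ν S) → Good S → ∃[ T ] (Good T × ν T ≡ 0 × SameComp n K S T)
    go S (acc smaller) good with ν S ≟ℕ 0
    ... | yes none = S , good , none , ε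
    ... | no some with reduce S good some
    ...   | T , goodT , S~T , fewer with go T (smaller fewer) goodT
    ...     | U , goodU , none , T~U = U , goodU , none , S~T ◅◅ T~U

  -- The reduction steps are opaque: their proofs evaluate certificates on symbolic windows,
  -- which the type checker must not unfold when the steps are used.
  opaque
    reduceRun4 : ∀ K S → IsMTDS n S → ∣ S ∣ + 1 ≤ K → ¬ μ run4 S ≡ 0 →
                 ∃[ T ] (IsMTDS n T × SameComp n K S T × ∣ T ∣ ≤ ∣ S ∣ × μ run4 T < μ run4 S)
    reduceRun4 K S mS S<K some with μ≢0 run4 S some
    ... | x , run = applyFlips S cs , proj₁ improved , proj₁ (proj₂ improved) , shrinks , proj₁ (proj₂ (proj₂ improved))
      where
      p : ℕ
      p = x + (n ∸ 7)
      open Window S p 10 (m≤m+n 4 6) 10≤n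
      cs : List ℕ
      cs = planI w₀
      certified : certifiedI w₀ ≡ true
      certified = forAllExtensions-read minimalTDS 14 certifiedI certificateI (view S p) (local-minimal S mS p)
      anchored : holds run4 (at w₀) 7 ≡ true
      anchored = read-anchor run4 S p 14 7 (≤ᵇ-sound refl) (≋-wrap (≤n (m≤m+n 7 3)) x) run
      checked : improves 10 (weight w₀ + 1) run4 w₀ cs ≡ true × weight (flipAll w₀ cs) ≤ weight w₀
      checked = certifiedI-elim w₀ certified anchored
      bound : ∣ S ∣ + (weight w₀ + 1) ≤ K + weight w₀
      bound = ≤-trans (≤-reflexive (solve 2 (λ s w → s :+ (w :+ con 1) := s :+ con 1 :+ w) refl ∣ S ∣ (weight w₀)))
                      (+-monoˡ-≤ (weight w₀) S<K)
      improved : IsMTDS n (applyFlips S cs) × SameComp n K S (applyFlips S cs)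
                 × μ run4 (applyFlips S cs) < μ run4 S × Reached (applyFlips S cs) (flipAll w₀ cs)
      improved = improve mS run4 (weight w₀ + 1) K cs (proj₁ checked) bound (≤-trans (m≤m+n ∣ S ∣ 1) S<K)
      shrinks : ∣ applyFlips S cs ∣ ≤ ∣ S ∣
      shrinks = +-cancelʳ-≤ (weight w₀) _ _ (≤-trans (≤-reflexive (Reached.balance (proj₂ (proj₂ (proj₂ improved)))))
                                                     (+-monoʳ-≤ ∣ S ∣ (proj₂ checked)))

  removeRun4 : ∀ S → IsMTDS n S → ∃[ T ] (IsMTDS n T × μ run4 T ≡ 0 × SameComp n (∣ S ∣ + 1) S T)
  removeRun4 S mS = forget (descend (∣ S ∣ + 1) Small (μ run4) reduce S (mS , ≤-refl))
    where
    Small : Subset n → Set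
    Small T = IsMTDS n T × ∣ T ∣ ≤ ∣ S ∣
    reduce : ∀ T → Small T → ¬ μ run4 T ≡ 0 → ∃[ U ] (Small U × SameComp n (∣ S ∣ + 1) T U × μ run4 U < μ run4 T)
    reduce T (mT , T≤S) some with reduceRun4 (∣ S ∣ + 1) T mT (+-monoˡ-≤ 1 T≤S) some
    ... | U , mU , T~U , U≤T , fewer = U , (mU , ≤-trans U≤T T≤S) , T~U , fewer
    forget : ∃[ T ] (Small T × μ run4 T ≡ 0 × SameComp n (∣ S ∣ + 1) S T) →
             ∃[ T ] (IsMTDS n T × μ run4 T ≡ 0 × SameComp n (∣ S ∣ + 1) S T)
    forget (T , (mT , _) , none , S~T) = T , mT , none , S~T

  -- (ii) Two consecutive P_3 components of a minimal TDS are exactly two vertices apart: with no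
  -- gap the second would start at a vertex outside S, with a gap of one v_i, v_{i+2}, v_{i+4}
  -- would all lie in S, and with a gap of three or more v_{i+4} would not be dominated.
  consecutive-gap : ∀ S → IsMTDS n S → ∀ i j d → compB n 3 S i ≡ true → compB n 3 S j ≡ true →
                    vtx n (toℕ i + 3 + d) ≡ j → (∀ t → t < d → memB n S (toℕ i + 3 + t) ≡ false) → d ≡ 2
  consecutive-gap S mS i j 0 ci cj e _ = true≢false startsJ (proj₂ (proj₂ (component-parts 3 S i ci)))
    where
    open ≡-Reasoning
    startsJ : memB n S (toℕ i + 3) ≡ true
    startsJ = begin
      memB n S (toℕ i + 3)         ≡⟨ cong (memB n S) (trans (+-identityʳ (toℕ i + 3 + 0)) (+-identityʳ (toℕ i + 3))) ⟨
      memB n S (toℕ i + 3 + 0 + 0) ≡⟨ memB-at S e 0 ⟨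
      memB n S (toℕ j + 0)         ≡⟨ component-run 3 S j cj 0 (s≤s z≤n) ⟩
      true                         ∎
  consecutive-gap S mS i j 1 ci cj e _ = ⊥-elim (redundant S (toℕ i) (minimal⇒irredundant 3≤n S mS) start middle next)
    where
    open ≡-Reasoning
    start : memB n S (toℕ i) ≡ true
    start = trans (cong (memB n S) (sym (+-identityʳ _))) (component-run 3 S i ci 0 (s≤s z≤n))
    middle : memB n S (toℕ i + 2) ≡ true
    middle = component-run 3 S i ci 2 ≤-refl
    next : memB n S (toℕ i + 4) ≡ true
    next = begin
      memB n S (toℕ i + 4)         ≡⟨ cong (memB n S) (solve 1 (λ t → t :+ con 4 := t :+ con 3 :+ con 1 :+ con 0) refl (toℕ i)) ⟩
      memB n S (toℕ i + 3 + 1 + 0) ≡⟨ memB-at S e 0 ⟨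
      memB n S (toℕ j + 0)         ≡⟨ component-run 3 S j cj 0 (s≤s z≤n) ⟩
      true                         ∎
  consecutive-gap S mS i j 2 ci cj e _ = refl
  consecutive-gap S mS i j (suc (suc (suc d))) ci cj e gap = true≢false (tds⇒dominating S (proj₁ mS) (toℕ i + 3)) undominated
    where
    undominated : memB n S (toℕ i + 3) ∨ memB n S (toℕ i + 3 + 2) ≡ false
    undominated = cong₂ _∨_ (trans (cong (memB n S) (sym (+-identityʳ _))) (gap 0 (s≤s z≤n))) (gap 2 (s≤s (s≤s (s≤s z≤n))))

  opaque
    -- (ii) Merging two consecutive P_3 components: add the vertex after the first and remove
    -- the first vertex of the second.
    reduceConsecutiveP3 : ∀ S → IsMTDS n S → HasConsecP3 n S →
      ∃[ T ] (IsMTDS n T × countComp n 3 T < countComp n 3 S × SameComp n (∣ S ∣ + 1) S T)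
    reduceConsecutiveP3 S mS (i , j , _ , ci , cj , d , e , gap) with consecutive-gap S mS i j d ci cj e gap
    ... | refl = applyFlips S cs , proj₁ improved , fewer , proj₁ (proj₂ improved)
      where
      q : ℕ
      q = toℕ i + (n ∸ 1)
      p : ℕ
      p = q + (n ∸ 1)
      open Window S p 8 (m≤m+n 4 4) (≤n (m≤m+n 8 2))
      cs : List ℕ
      cs = 5 ∷ 7 ∷ []
      certified : certifiedII w₀ ≡ true
      certified = forAllExtensions-read minimalTDS 12 certifiedII certificateII (view S p) (local-minimal S mS p)
      -- the first component is seen at window position 1, the second at position 6
      second : p + 6 ≋ toℕ j + (n ∸ 1)
      second = begin
        (p + 6) % n                      ≡⟨ ≋-back 1≤n q 5 ⟩
        (q + 5) % n                      ≡⟨ cong (_% n) (solve 2 (λ t d → t :+ d :+ con 5 := t :+ con 3 :+ con 2 :+ d) refl (toℕ i) (n ∸ 1)) ⟩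
        (toℕ i + 3 + 2 + (n ∸ 1)) % n    ≡⟨ ≋-+ʳ (n ∸ 1) (toℕ-≋ e) ⟨
        (toℕ j + (n ∸ 1)) % n            ∎
        where open ≡-Reasoning
      improving : improves 8 (weight w₀ + 1) p3Component w₀ cs ≡ true
      improving = certifiedII-elim w₀ certified
        (read-anchor p3Component S p 12 1 (≤ᵇ-sound refl) (≋-wrap 1≤n q) (trans (sym (compB3≡p3Component S i)) ci))
        (read-anchor p3Component S p 12 6 (≤ᵇ-sound refl) second (trans (sym (compB3≡p3Component S j)) cj))
      bound : ∣ S ∣ + (weight w₀ + 1) ≤ (∣ S ∣ + 1) + weight w₀
      bound = ≤-reflexive (solve 2 (λ s w → s :+ (w :+ con 1) := s :+ con 1 :+ w) refl ∣ S ∣ (weight w₀))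
      improved : IsMTDS n (applyFlips S cs) × SameComp n (∣ S ∣ + 1) S (applyFlips S cs)
                 × μ p3Component (applyFlips S cs) < μ p3Component S × Reached (applyFlips S cs) (flipAll w₀ cs)
      improved = improve mS p3Component (weight w₀ + 1) (∣ S ∣ + 1) cs improving bound (m≤m+n ∣ S ∣ 1)
      fewer : countComp n 3 (applyFlips S cs) < countComp n 3 S
      fewer = subst₂ _<_ (sym (countComp3≡μ (applyFlips S cs))) (sym (countComp3≡μ S)) (proj₁ (proj₂ (proj₂ improved)))

    reduceRun3 : ∀ g → IsGammaT n g → ∀ S → IsMTDS n S × Everywhere noRun4 S → ¬ μ run3 S ≡ 0 →
                 ∃[ T ] ((IsMTDS n T × Everywhere noRun4 T) × SameComp n (g + 1) S T × μ run3 T < μ run3 S)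
    reduceRun3 g (_ , maximal) S (mS , noRun4S) some with μ≢0 run3 S some
    ... | x , run = T , (proj₁ improved , noRun4T) , proj₁ (proj₂ improved) , proj₁ (proj₂ (proj₂ improved))
      where
      pb : ℕ
      pb = x + (n ∸ 9)
      big : Word
      big = read (view S pb) 22
      certified : certifiedIII big ≡ true
      certified = forAllExtensions-read minimalTDSnoRun4 22 certifiedIII certificateIII (view S pb) (local-minimalNoRun4 S mS noRun4S pb)
      planned : proj₁ (planIII big) ≤ 8 × checkWindowIII (take 14 (drop (proj₁ (planIII big)) big)) (proj₂ (planIII big)) ≡ true
      planned = certifiedIII-elim big certified (read-anchor run3 S pb 22 9 (≤ᵇ-sound refl) (≋-wrap (≤n (m≤m+n 9 1)) x) run)
      s : ℕ
      s = proj₁ (planIII big)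
      cs : List ℕ
      cs = proj₂ (planIII big)
      p : ℕ
      p = pb + s
      open Window S p 10 (m≤m+n 4 6) 10≤n
      window≡ : take 14 (drop s big) ≡ w₀
      window≡ = trans (take-drop-read (view S pb) s 14 22 (+-monoˡ-≤ 14 (proj₁ planned)))
                      (read-cong 14 (λ y _ → cong (memB n S) (sym (+-assoc pb s y))))
      checked : checkWindowIII w₀ cs ≡ true
      checked = subst (λ v → checkWindowIII v cs ≡ true) window≡ (proj₂ planned)
      T : Subset n
      T = applyFlips S cs
      u : Word
      u = flipAll w₀ cs
      B : ℕ
      B = (weight w₀ ⊔ weight u) + 1
      parts : improves 10 B run3 w₀ cs ≡ true × allBelow 10 (holds noRun4 (at u)) ≡ true
      parts = ∧-split checked
      improvedWithin : ∀ K → ∣ S ∣ + B ≤ K + weight w₀ → ∣ S ∣ ≤ K →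
                       IsMTDS n T × SameComp n K S T × μ run3 T < μ run3 S × Reached T u
      improvedWithin K = improve mS run3 B K cs (proj₁ parts)
      -- with a generous size bound the certificate already shows that T is a minimal TDS,
      -- hence |T| ≤ Γ_t; then all sizes on the walk are at most Γ_t + 1
      generous : IsMTDS n T × SameComp n (∣ S ∣ + B) S T × μ run3 T < μ run3 S × Reached T u
      generous = improvedWithin (∣ S ∣ + B) (m≤m+n _ _) (m≤m+n _ _)
      improved : IsMTDS n T × SameComp n (g + 1) S T × μ run3 T < μ run3 S × Reached T u
      improved = improvedWithin (g + 1)
        (sizes-within (maximal S mS) (maximal T (proj₁ generous)) (Reached.balance (proj₂ (proj₂ (proj₂ generous)))))
        (≤-trans (maximal S mS) (m≤m+n g 1))
      noRun4T : Everywhere noRun4 T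
      noRun4T = tracks-everywhere (Reached.tracks (proj₂ (proj₂ (proj₂ improved)))) noRun4 (proj₂ parts) noRun4S

  removeRun3 : ∀ g → IsGammaT n g → ∀ S → IsMTDS n S → Everywhere noRun4 S →
               ∃[ T ] (IsMTDS n T × μ run3 T ≡ 0 × SameComp n (g + 1) S T)
  removeRun3 g γ S mS noRun4S = forget (descend (g + 1) Good (μ run3) (reduceRun3 g γ) S (mS , noRun4S))
    where
    Good : Subset n → Set
    Good T = IsMTDS n T × Everywhere noRun4 T
    forget : ∃[ T ] (Good T × μ run3 T ≡ 0 × SameComp n (g + 1) S T) →
             ∃[ T ] (IsMTDS n T × μ run3 T ≡ 0 × SameComp n (g + 1) S T)
    forget (T , (mT , _) , none , S~T) = T , mT , none , S~T

-- Lemma 3.5. (i) Runs of four, hence P_4 components, are removed one at a time without exceeding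
-- |S| + 1; (ii) two consecutive P_3 components are merged; (iii) in the absence of P_4 components,
-- runs of three, hence P_3 components, are removed without exceeding Γ_t(C_n) + 1.
lemma3p5 : (n : ℕ) .{{_ : NonZero n}} → 10 ≤ n →
    -- (i)
    (∀ (S : Subset n) → IsMTDS n S → (∃[ i ] (compB n 4 S i ≡ true)) →
      ∃[ S' ] (IsMTDS n S' × countComp n 4 S' ≡ 0 × SameComp n (∣ S ∣ + 1) S S'))
    -- (ii)
    × (∀ (S : Subset n) → IsMTDS n S → HasConsecP3 n S →
      ∃[ S' ] (IsMTDS n S' × countComp n 3 S' < countComp n 3 S × SameComp n (∣ S ∣ + 1) S S'))
    -- (iii)
    × (∀ (g : ℕ) → IsGammaT n g → ∀ (S : Subset n) → IsMTDS n S →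
      (∃[ i ] (compB n 3 S i ≡ true)) → (∃[ i ] (compB n 2 S i ≡ true)) → countComp n 4 S ≡ 0 →
      ∃[ S' ] (IsMTDS n S' × countComp n 3 S' ≡ 0 × SameComp n (g + 1) S S'))
lemma3p5 n 10≤n = partI , reduceConsecutiveP3 , partIII
  where
  open Cyclic n
  open Reductions n 10≤n
  partI : ∀ S → IsMTDS n S → ∃[ i ] (compB n 4 S i ≡ true) →
          ∃[ S' ] (IsMTDS n S' × countComp n 4 S' ≡ 0 × SameComp n (∣ S ∣ + 1) S S')
  partI S mS _ with removeRun4 S mS
  ... | T , mT , none , S~T = T , mT , countComp≡0 4 run4 T (run4-intro T) none , S~T
  partIII : ∀ g → IsGammaT n g → ∀ S → IsMTDS n S → ∃[ i ] (compB n 3 S i ≡ true) → ∃[ i ] (compB n 2 S i ≡ true) →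
            countComp n 4 S ≡ 0 → ∃[ S' ] (IsMTDS n S' × countComp n 3 S' ≡ 0 × SameComp n (g + 1) S S')
  partIII g γ S mS _ _ noP4 with removeRun3 g γ S mS (noP4⇒noRun4 S mS 3≤n noP4)
  ... | T , mT , none , S~T = T , mT , countComp≡0 3 run3 T (run3-intro T) none , S~T
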